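{- Let $P$ be the definite logic program (called NQUEENS) consisting of the four clauses \[ \begin{array}{l} \mathit{pqs}(0,\_,\_,\_).\\ \mathit{pqs}(s(I),Cs,Us,[\_|Ds]) \leftarrow \mathit{pqs}(I,Cs,[\_|Us],Ds),\ \mathit{pq}(s(I),Cs,Us,Ds).\\ \mathit{pq}(I,[I|\_],[I|\_],[I|\_]).\\ \mathit{pq}(I,[\_|Cs],[\_|Us],[\_|Ds]) \leftarrow \mathit{pq}(I,Cs,Us,Ds). \end{array} \] Let $Q_0$ be an initial query in which the first argument of every atom (with predicate symbol $\mathit{pqs}$ or $\mathit{pq}$) is a ground term. Then in every query of every SLD-derivation of $P$ starting with $Q_0$ (under any selection rule), the first argument of every atom is ground.
   Context: Notation is Prolog notation: identifiers beginning with an upper-case letter are variables; $0$ is a constant, $s$ a unary function symbol, $[H|T]$ denotes the list constructor applied to $H$ and $T$; each occurrence of the symbol $\_$ stands for a distinct fresh variable. SLD-derivations use standardized-apart (variable-renamed) clauses and most general unifiers as usual. -}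

module Defs where

open import Data.Nat using (ℕ)
open import Data.List using (List; []; _∷_; _++_; map; concatMap)
open import Data.List.Membership.Propositional using (_∈_)
open import Data.List.Relation.Unary.All using (All)
open import Data.Product using (Σ; ∃; _×_; _,_)
open import Data.Sum using (_⊎_)
open import Data.Unit using (⊤)
open import Data.Empty using (⊥)
open import Function.Definitions using (Injective)
open import Relation.Binary.PropositionalEquality using (_≡_)

-- First-order terms. Variables are natural numbers; function symbols
-- are coded by natural numbers (arity = length of the argument list).

data Term : Set where
  var : ℕ → Term
  fn  : ℕ → List Term → Term

zeroF sF consF : ℕ
zeroF = 0
sF    = 1
consF = 2

𝟘 : Term
𝟘 = fn zeroF []

s : Term → Term
s t = fn sF (t ∷ [])

[_∣_] : Term → Term → Term
[ h ∣ t ] = fn consF (h ∷ t ∷ [])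

mutual
  varsT : Term → List ℕ
  varsT (var x)   = x ∷ []
  varsT (fn f ts) = varsTs ts

  varsTs : List Term → List ℕ
  varsTs []       = []
  varsTs (t ∷ ts) = varsT t ++ varsTs ts

Ground : Term → Set
Ground t = varsT t ≡ []

Subst : Set
Subst = ℕ → Term

mutual
  _⟨_⟩ : Term → Subst → Term
  var x   ⟨ σ ⟩ = σ x
  fn f ts ⟨ σ ⟩ = fn f (ts ⟨ σ ⟩*)

  _⟨_⟩* : List Term → Subst → List Term
  []       ⟨ σ ⟩* = []
  (t ∷ ts) ⟨ σ ⟩* = (t ⟨ σ ⟩) ∷ (ts ⟨ σ ⟩*)

pqsP pqP : ℕ
pqsP = 0
pqP  = 1

record Atom : Set where
  constructor atom
  field
    pred : ℕ
    args : List Term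
open Atom public

_⟨_⟩ₐ : Atom → Subst → Atom
atom p ts ⟨ σ ⟩ₐ = atom p (ts ⟨ σ ⟩*)

varsA : Atom → List ℕ
varsA (atom p ts) = varsTs ts

Query : Set
Query = List Atom

_⟨_⟩q : Query → Subst → Query
Q ⟨ σ ⟩q = map (_⟨ σ ⟩ₐ) Q

varsQ : Query → List ℕ
varsQ = concatMap varsA

record Clause : Set where
  constructor _⇐_
  field
    head : Atom
    body : List Atom
open Clause public

varsC : Clause → List ℕ
varsC (h ⇐ b) = varsA h ++ varsQ b

Program : Set
Program = List Clause

renameC : (ℕ → ℕ) → Clause → Clause
renameC ρ (h ⇐ b) = (h ⟨ ρ' ⟩ₐ) ⇐ (b ⟨ ρ' ⟩q)
  where ρ' : Subst
        ρ' x = var (ρ x)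

Variant : Clause → Clause → Set
Variant C' C = Σ (ℕ → ℕ) λ ρ → Injective _≡_ _≡_ ρ × (C' ≡ renameC ρ C)

Unifier : Subst → Atom → Atom → Set
Unifier θ A B = A ⟨ θ ⟩ₐ ≡ B ⟨ θ ⟩ₐ

MoreGeneral : Subst → Subst → Set
MoreGeneral θ σ = ∃ λ (δ : Subst) → ∀ x → σ x ≡ (θ x) ⟨ δ ⟩

MGU : Subst → Atom → Atom → Set
MGU θ A B = Unifier θ A B × (∀ σ → Unifier σ A B → MoreGeneral θ σ)

Disjoint : List ℕ → List ℕ → Set
Disjoint xs ys = ∀ {x} → x ∈ xs → x ∈ ys → ⊥

-- Derivation P Q₀ Q used : Q is a query of an SLD-derivation of P
-- starting with Q₀; 'used' lists all variables occurring in the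
-- derivation so far (queries and clause variants), so that each new
-- clause variant is standardized apart from the whole derivation so far.

data Derivation (P : Program) (Q₀ : Query) : Query → List ℕ → Set where
  start : Derivation P Q₀ Q₀ (varsQ Q₀)
  step  : ∀ {used} (L R : Query) (A : Atom) (C C' : Clause) (θ : Subst) →
          Derivation P Q₀ (L ++ A ∷ R) used →
          C ∈ P →
          Variant C' C →
          Disjoint (varsC C') used →
          MGU θ A (head C') →
          Derivation P Q₀ ((L ++ body C' ++ R) ⟨ θ ⟩q)
                     (used ++ varsC C' ++ varsQ ((L ++ body C' ++ R) ⟨ θ ⟩q))

-- The program NQUEENS (each '_' is a distinct fresh variable)

private
  v : ℕ → Term
  v = var

pqs pq : Term → Term → Term → Term → Atom
pqs a b c d = atom pqsP (a ∷ b ∷ c ∷ d ∷ [])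
pq  a b c d = atom pqP  (a ∷ b ∷ c ∷ d ∷ [])

clause1 : Clause
clause1 = pqs 𝟘 (v 0) (v 1) (v 2) ⇐ []

-- pqs(s(I),Cs,Us,[_|Ds]) ← pqs(I,Cs,[_|Us],Ds), pq(s(I),Cs,Us,Ds).
-- I=0, Cs=1, Us=2, Ds=3, fresh 4 and 5
clause2 : Clause
clause2 = pqs (s (v 0)) (v 1) (v 2) [ v 4 ∣ v 3 ]
          ⇐ (pqs (v 0) (v 1) [ v 5 ∣ v 2 ] (v 3) ∷ pq (s (v 0)) (v 1) (v 2) (v 3) ∷ [])

clause3 : Clause
clause3 = pq (v 0) [ v 0 ∣ v 1 ] [ v 0 ∣ v 2 ] [ v 0 ∣ v 3 ] ⇐ []

-- pq(I,[_|Cs],[_|Us],[_|Ds]) ← pq(I,Cs,Us,Ds).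
-- I=0, Cs=1, Us=2, Ds=3, fresh 4,5,6
clause4 : Clause
clause4 = pq (v 0) [ v 4 ∣ v 1 ] [ v 5 ∣ v 2 ] [ v 6 ∣ v 3 ]
          ⇐ (pq (v 0) (v 1) (v 2) (v 3) ∷ [])

NQUEENS : Program
NQUEENS = clause1 ∷ clause2 ∷ clause3 ∷ clause4 ∷ []

FirstArgGround : Atom → Set
FirstArgGround (atom p [])      = ⊤
FirstArgGround (atom p (t ∷ _)) = Ground t

RelevantPred : ℕ → Set
RelevantPred p = (p ≡ pqsP) ⊎ (p ≡ pqP)

GoodAtom : Atom → Set
GoodAtom A = RelevantPred (pred A) → FirstArgGround A

GoodQuery : Query → Set
GoodQuery Q = All GoodAtom Q

-- NQUEENS is well-moded with the first argument as input: the first argument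
-- of each body atom has its variables among those of the first argument of
-- the head (s(I) passes on I and s(I), the recursive pq passes on I).  A
-- unifier of a selected atom with a ground first argument and the head of a
-- clause therefore grounds the first arguments of the new body atoms, while
-- the ground first arguments of the remaining atoms are fixed by every
-- substitution.
module Submission where

open import Defs
open import Data.Nat using (ℕ)
open import Data.List using (List; []; _∷_)
open import Data.List.Properties using (++-conicalˡ; ++-conicalʳ)
open import Data.List.Relation.Unary.All as All using (All; []; _∷_)
open import Data.List.Relation.Unary.All.Properties using (++⁺; ++⁻; map⁺)
open import Data.List.Relation.Unary.Any using (here; there)
open import Data.List.Membership.Propositional using (_∈_)
open import Data.Product using (_,_)
open import Data.Sum using (inj₁; inj₂)
open import Data.Unit using (tt)
open import Relation.Binary.PropositionalEquality using (_≡_; refl; sym; cong; cong₂; subst)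

mutual
  ⟨⟩-ground : ∀ t (σ : Subst) → Ground t → t ⟨ σ ⟩ ≡ t
  ⟨⟩-ground (fn f ts) σ ground = cong (fn f) (⟨⟩*-ground ts σ ground)

  ⟨⟩*-ground : ∀ ts (σ : Subst) → varsTs ts ≡ [] → ts ⟨ σ ⟩* ≡ ts
  ⟨⟩*-ground []       σ ground = refl
  ⟨⟩*-ground (t ∷ ts) σ ground =
    cong₂ _∷_ (⟨⟩-ground t σ (++-conicalˡ (varsT t) (varsTs ts) ground))
              (⟨⟩*-ground ts σ (++-conicalʳ (varsT t) (varsTs ts) ground))

Ground-s⁻ : ∀ t → Ground (s t) → Ground t
Ground-s⁻ t ground = ++-conicalˡ (varsT t) [] ground

GoodAtom-⟨⟩ : ∀ (θ : Subst) A → GoodAtom A → GoodAtom (A ⟨ θ ⟩ₐ)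
GoodAtom-⟨⟩ θ (atom p [])       good relevant = tt
GoodAtom-⟨⟩ θ (atom p (t ∷ ts)) good relevant =
  subst Ground (sym (⟨⟩-ground t θ (good relevant))) (good relevant)

GoodAtom-unified : ∀ (θ : Subst) A H → Unifier θ A H → GoodAtom A → GoodAtom (H ⟨ θ ⟩ₐ)
GoodAtom-unified θ A H unifies good = subst GoodAtom unifies (GoodAtom-⟨⟩ θ A good)

NQUEENS-body-good : ∀ C C' (θ : Subst) A → C ∈ NQUEENS → Variant C' C → GoodAtom A →
            Unifier θ A (head C') → All (λ B → GoodAtom (B ⟨ θ ⟩ₐ)) (body C')
NQUEENS-body-good _ _ θ A (here refl) (ρ , _ , refl) good unifies = []
NQUEENS-body-good _ C' θ A (there (here refl)) (ρ , _ , refl) good unifies =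
  (λ _ → Ground-s⁻ (θ (ρ 0)) sI-ground) ∷ (λ _ → sI-ground) ∷ []
  where
    sI-ground : Ground (s (var (ρ 0)) ⟨ θ ⟩)
    sI-ground = GoodAtom-unified θ A (head C') unifies good (inj₁ refl)
NQUEENS-body-good _ _ θ A (there (there (here refl))) (ρ , _ , refl) good unifies = []
NQUEENS-body-good _ C' θ A (there (there (there (here refl)))) (ρ , _ , refl) good unifies =
  (λ _ → GoodAtom-unified θ A (head C') unifies good (inj₂ refl)) ∷ []

lemma1 : (Q₀ Q : Query) (used : List ℕ) →
    GoodQuery Q₀ →
    Derivation NQUEENS Q₀ Q used →
    GoodQuery Q
lemma1 Q₀ .Q₀ _ good₀ start = good₀
lemma1 Q₀ _ _ good₀ (step L R A C C' θ derivation C∈P variant _ (unifies , _))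
  with ++⁻ L (lemma1 Q₀ _ _ good₀ derivation)
... | goodL , goodA ∷ goodR =
  map⁺ (++⁺ (instantiate goodL)
            (++⁺ (NQUEENS-body-good C C' θ A C∈P variant goodA unifies) (instantiate goodR)))
  where
    instantiate : ∀ {Q} → GoodQuery Q → All (λ B → GoodAtom (B ⟨ θ ⟩ₐ)) Q
    instantiate = All.map (λ {B} → GoodAtom-⟨⟩ θ B)
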